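{- Let $G$ be a graph with an almost universal node $u$ (a node adjacent to all nodes of $G$ other than itself except exactly one). If the graph $G'$ obtained from $G$ by removing $u$ is a PCG, then $G$ is a 2-interval PCG.
   Context: Graphs are finite and simple. For a tree $T$ with non-negative real edge weights whose leaves are identified with the nodes of a graph, $d_T(u,v)$ denotes the weighted distance in $T$ between the leaves associated to $u$ and $v$. A graph $G=(V,E)$ is a PCG (pairwise compatibility graph) if there exist a tree $T$ with non-negative real edge weights, a bijection between $V$ and the leaves of $T$, and an interval $I$ of the non-negative real half-line such that for distinct $u,v\in V$, $(u,v)\in E$ if and only if $d_T(u,v)\in I$. A graph is a 2-interval PCG if the same holds with two disjoint intervals $I_1,I_2$ of the non-negative real half-line in place of $I$, with the condition $d_T(u,v)\in I_1\cup I_2$.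
   Formalization: The edge weights of the trees and the intervals, for $G'$ as a PCG and for $G$ as a 2-interval PCG, are taken over the non-negative rationals rather than the non-negative reals. -}

module Defs where

open import Data.Nat using (ℕ; zero; suc; _≤_)
open import Data.Fin using (Fin; punchIn)
open import Data.List using (List; []; _∷_)
open import Data.List.Relation.Unary.Unique.Propositional using (Unique)
open import Data.Rational using (ℚ; 0ℚ; _+_) renaming (_≤_ to _≤ℚ_)
open import Data.Product using (Σ; ∃; _×_; _,_)
open import Data.Sum using (_⊎_)
open import Data.Empty using (⊥)
open import Relation.Nullary using (¬_)
open import Relation.Binary.PropositionalEquality using (_≡_; _≢_)
open import Function.Bundles using (_⇔_)
open import Level using (Level; 0ℓ)

record Graph (n : ℕ) : Set₁ where
  field
    Adj    : Fin n → Fin n → Set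
    sym    : ∀ {x y} → Adj x y → Adj y x
    irrefl : ∀ {x} → ¬ Adj x x
open Graph public

-- G minus the vertex u (vertices of G - u are re-indexed by punchIn u)
removeVertex : ∀ {n} → Graph (suc n) → Fin (suc n) → Graph n
removeVertex G u = record
  { Adj    = λ i j → Adj G (punchIn u i) (punchIn u j)
  ; sym    = sym G
  ; irrefl = irrefl G }

AlmostUniversal : ∀ {n} → Graph n → Fin n → Set
AlmostUniversal G u =
  Σ _ λ x → (x ≢ u) × (¬ Adj G u x) ×
    (∀ y → y ≢ u → y ≢ x → Adj G u y)

data Walk {m : ℕ} (A : Fin m → Fin m → Set) : Fin m → Fin m → Set where
  []  : ∀ {x} → Walk A x x
  _∷_ : ∀ {x y z} → A x y → Walk A y z → Walk A x z

vertices : ∀ {m} {A : Fin m → Fin m → Set} {x y} → Walk A x y → List (Fin m)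
vertices {x = x} []      = x ∷ []
vertices {x = x} (_ ∷ p) = x ∷ vertices p

walkLength : ∀ {m} {A : Fin m → Fin m → Set} {x y} → Walk A x y → ℕ
walkLength []      = 0
walkLength (_ ∷ p) = suc (walkLength p)

IsPath : ∀ {m} {A : Fin m → Fin m → Set} {x y} → Walk A x y → Set
IsPath p = Unique (vertices p)

record WeightedTree (m : ℕ) : Set₁ where
  field
    TAdj      : Fin m → Fin m → Set
    tsym      : ∀ {x y} → TAdj x y → TAdj y x
    tirrefl   : ∀ {x} → ¬ TAdj x x
    connected : ∀ x y → Walk TAdj x y
    -- acyclic: no edge xy together with a path y..x of length ≥ 2
    --          (i.e. no cycle of length ≥ 3)
    acyclic   : ∀ x y → TAdj x y → (p : Walk TAdj y x) → IsPath p →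
                2 ≤ walkLength p → ⊥
    weight    : Fin m → Fin m → ℚ
    wsym      : ∀ x y → weight x y ≡ weight y x
    wnonneg   : ∀ x y → 0ℚ ≤ℚ weight x y
open WeightedTree public

walkWeight : ∀ {m} (T : WeightedTree m) {x y} → Walk (TAdj T) x y → ℚ
walkWeight T []                   = 0ℚ
walkWeight T (_∷_ {x} {y} _ p) = weight T x y + walkWeight T p

TreeDist : ∀ {m} (T : WeightedTree m) → Fin m → Fin m → ℚ → Set
TreeDist T x y d = Σ (Walk (TAdj T) x y) λ p → IsPath p × (walkWeight T p ≡ d)

-- leaves: nodes of degree at most one (degree 0 only in the one-node tree)
IsLeaf : ∀ {m} → WeightedTree m → Fin m → Set
IsLeaf T t = ∀ a b → TAdj T t a → TAdj T t b → a ≡ b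

record LeafBijection {n m : ℕ} (T : WeightedTree m) : Set where
  field
    leaf        : Fin n → Fin m
    injective   : ∀ u v → leaf u ≡ leaf v → u ≡ v
    isLeaf      : ∀ v → IsLeaf T (leaf v)
    surjective  : ∀ t → IsLeaf T t → ∃ λ v → leaf v ≡ t
open LeafBijection public

record Interval : Set₁ where
  field
    _∈I_    : ℚ → Set
    nonneg : ∀ x → _∈I_ x → 0ℚ ≤ℚ x
    convex : ∀ x y z → _∈I_ x → _∈I_ z → x ≤ℚ y → y ≤ℚ z → _∈I_ y
open Interval public

Disjoint : Interval → Interval → Set
Disjoint I J = ∀ x → _∈I_ I x → _∈I_ J x → ⊥

IsPCG : ∀ {n} → Graph n → Set₁
IsPCG {n} G =
  Σ ℕ λ m → Σ (WeightedTree m) λ T → Σ (LeafBijection {n} T) λ L →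
  Σ Interval λ I →
    ∀ u v → u ≢ v →
      Adj G u v ⇔ (∃ λ d → TreeDist T (leaf L u) (leaf L v) d × _∈I_ I d)

Is2IntervalPCG : ∀ {n} → Graph n → Set₁
Is2IntervalPCG {n} G =
  Σ ℕ λ m → Σ (WeightedTree m) λ T → Σ (LeafBijection {n} T) λ L →
  Σ Interval λ I₁ → Σ Interval λ I₂ → Disjoint I₁ I₂ ×
    (∀ u v → u ≢ v →
      Adj G u v ⇔ (∃ λ d → TreeDist T (leaf L u) (leaf L v) d ×
                              (_∈I_ I₁ d ⊎ _∈I_ I₂ d)))

-- Take a tree realising G − u with the interval I, and let B bound its leaf distances.
-- Lengthen the pendant edge of every leaf by 1: leaf distances become d + 2, so distinct leaves
-- are now at distance at least 2. Move the leaf of x to a new node hanging from its old node t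
-- by an edge of weight 0, and attach u to t by an edge of weight W = B + 3. Then d(u, x) = W,
-- d(u, y) ≥ W + 2 for every other y, and the remaining distances lie in [2, B + 2], so G is
-- realised by the disjoint intervals (I + 2) ∩ [0, B + 2] and [W + 2, ∞).
-- Lengthening needs every leaf to have a neighbour, i.e. G − u to have at least two vertices;
-- when it has one, G is two non-adjacent vertices, realised by one edge and empty intervals.

module Submission where

open import Data.Empty using (⊥; ⊥-elim)
open import Data.Fin using (Fin; zero; suc; punchIn; punchOut; _≟_)
open import Data.Fin.Properties
  using (0≢1+n; suc-injective; injective⇒≤; punchIn-punchOut; punchIn-injective; punchInᵢ≢i)
open import Data.List as List using (List; []; _∷_; _++_; [_]; map; length; lookup; allFin)
open import Data.List.Membership.Propositional using (_∈_; _∉_)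
open import Data.List.Membership.Propositional.Properties using (∈-lookup; ∈-allFin)
open import Data.List.Properties using (unfold-reverse)
open import Data.List.Relation.Unary.All as All using (All; []; _∷_)
open import Data.List.Relation.Unary.All.Properties using (¬Any⇒All¬)
open import Data.List.Relation.Unary.AllPairs using ([]; _∷_)
open import Data.List.Relation.Unary.Any using (here; there; any?)
import Data.List.Relation.Unary.Any.Properties as Any
open import Data.List.Relation.Unary.Unique.Propositional using (Unique)
import Data.List.Relation.Unary.Unique.Propositional.Properties as Unique
open import Data.Nat as ℕ using (ℕ; zero; suc; s≤s)
import Data.Nat.Properties as ℕ
open import Data.Product using (Σ; ∃; _×_; _,_; proj₁; proj₂)
open import Data.Rational using (ℚ; 0ℚ; 1ℚ; _+_; -_; _-_; _≤_; _<_; +-0-rawMonoid)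
import Data.Rational.Properties as ℚ
open import Algebra.Definitions.RawMonoid +-0-rawMonoid using (sum) renaming (_×_ to _·_)
open import Data.Sum using (_⊎_; inj₁; inj₂)
open import Data.Vec.Functional using (updateAt; insertAt)
open import Data.Vec.Functional.Properties
  using (updateAt-updates; updateAt-minimal; updateAt-id-local; insertAt-lookup; insertAt-punchIn)
open import Function using (_∘_; id)
open import Function.Bundles using (_⇔_; mk⇔; Equivalence)
open import Function.Properties.Equivalence using (⇔-setoid)
open import Level using (0ℓ)
open import Relation.Binary.PropositionalEquality as ≡
  using (_≡_; _≢_; refl; trans; cong; cong₂; subst; subst₂)
import Relation.Binary.Reasoning.Setoid as SetoidReasoning
open import Relation.Nullary using (¬_; Dec; yes; no)
open import Relation.Nullary.Decidable using (dec⇒maybe)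
open import Tactic.RingSolver using (solve-∀)
open import Tactic.RingSolver.Core.AlmostCommutativeRing using (AlmostCommutativeRing; fromCommutativeRing)

open import Defs

ℚ-ring : AlmostCommutativeRing 0ℓ 0ℓ
ℚ-ring = fromCommutativeRing ℚ.+-*-commutativeRing λ x → dec⇒maybe (0ℚ ℚ.≟ x)

[p+q]-p≡q : ∀ p q → p + q - p ≡ q
[p+q]-p≡q = solve-∀ ℚ-ring

p+[q-p]≡q : ∀ p q → p + (q - p) ≡ q
p+[q-p]≡q = solve-∀ ℚ-ring

[p+q]-q≡p : ∀ p q → p + q - q ≡ p
[p+q]-q≡p = solve-∀ ℚ-ring

p≤p+q : ∀ {p q} → 0ℚ ≤ q → p ≤ p + q
p≤p+q {p} {q} 0≤q = subst (_≤ p + q) (ℚ.+-identityʳ p) (ℚ.+-monoʳ-≤ p 0≤q)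

p≤q+p : ∀ {p q} → 0ℚ ≤ q → p ≤ q + p
p≤q+p {p} {q} 0≤q = subst (_≤ q + p) (ℚ.+-identityˡ p) (ℚ.+-monoˡ-≤ p 0≤q)

sum-nonneg : ∀ {n} (f : Fin n → ℚ) → (∀ i → 0ℚ ≤ f i) → 0ℚ ≤ sum f
sum-nonneg {zero}  f 0≤f = ℚ.≤-refl
sum-nonneg {suc n} f 0≤f = ℚ.+-mono-≤ (0≤f zero) (sum-nonneg (f ∘ suc) (0≤f ∘ suc))

≤-sum : ∀ {n} (f : Fin n → ℚ) → (∀ i → 0ℚ ≤ f i) → ∀ i → f i ≤ sum f
≤-sum f 0≤f zero    = p≤p+q (sum-nonneg (f ∘ suc) (0≤f ∘ suc))
≤-sum f 0≤f (suc i) = ℚ.≤-trans (≤-sum (f ∘ suc) (0≤f ∘ suc) i) (p≤q+p (0≤f zero))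

·-nonneg : ∀ n {q} → 0ℚ ≤ q → 0ℚ ≤ n · q
·-nonneg zero    0≤q = ℚ.≤-refl
·-nonneg (suc n) 0≤q = ℚ.+-mono-≤ 0≤q (·-nonneg n 0≤q)

p+q≰p : ∀ {p q} → 0ℚ < q → ¬ (p + q ≤ p)
p+q≰p {p} {q} 0<q p+q≤p = ℚ.<-irrefl refl (ℚ.<-≤-trans 0<q q≤0)
  where
  q≤0 : q ≤ 0ℚ
  q≤0 = subst₂ _≤_ ([p+q]-p≡q p q) (ℚ.+-inverseʳ p) (ℚ.+-monoˡ-≤ (- p) p+q≤p)

Unique-reverse : ∀ {a} {A : Set a} {xs : List A} → Unique xs → Unique (List.reverse xs)
Unique-reverse {xs = []}     []          = []
Unique-reverse {xs = x ∷ xs} (x∉xs ∷ u) = subst Unique (≡.sym (unfold-reverse x xs))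
  (Unique.++⁺ (Unique-reverse u) ([] ∷ []) λ where
    (x∈ , here refl) → All.lookup x∉xs (Any.reverse⁻ x∈) refl
    (_  , there ()))

Unique⇒lookup-injective : ∀ {a} {A : Set a} {xs : List A} → Unique xs →
                          ∀ {i j} → lookup xs i ≡ lookup xs j → i ≡ j
Unique⇒lookup-injective {xs = _ ∷ _} _          {zero}  {zero}  _  = refl
Unique⇒lookup-injective {xs = _ ∷ _} (x∉xs ∷ _) {zero}  {suc j} eq = ⊥-elim (All.lookup x∉xs (∈-lookup j) eq)
Unique⇒lookup-injective {xs = _ ∷ _} (x∉xs ∷ _) {suc i} {zero}  eq =
  ⊥-elim (All.lookup x∉xs (∈-lookup i) (≡.sym eq))
Unique⇒lookup-injective {xs = _ ∷ _} (_ ∷ u)    {suc i} {suc j} eq = cong suc (Unique⇒lookup-injective u eq)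

Unique-length≤ : ∀ {m} {xs : List (Fin m)} → Unique xs → length xs ℕ.≤ m
Unique-length≤ u = injective⇒≤ (Unique⇒lookup-injective u)

data PunchView {n} (u : Fin (suc n)) : Fin (suc n) → Set where
  pivot   : PunchView u u
  punched : ∀ y → PunchView u (punchIn u y)

punchView : ∀ {n} (u z : Fin (suc n)) → PunchView u z
punchView u z with u ≟ z
... | yes refl = pivot
... | no  u≢z  = subst (PunchView u) (punchIn-punchOut u≢z) (punched (punchOut u≢z))

another : ∀ {k} (v : Fin (suc (suc k))) → ∃ (_≢ v)
another zero    = suc zero , 0≢1+n ∘ ≡.sym
another (suc _) = zero , 0≢1+n

module ⇔-Reasoning = SetoidReasoning (⇔-setoid 0ℓ)

module Walks {m : ℕ} {A : Fin m → Fin m → Set} where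

  source∈vertices : ∀ {x y} (p : Walk A x y) → x ∈ vertices p
  source∈vertices []      = here refl
  source∈vertices (_ ∷ _) = here refl

  target∈vertices : ∀ {x y} (p : Walk A x y) → y ∈ vertices p
  target∈vertices []      = here refl
  target∈vertices (_ ∷ p) = there (target∈vertices p)

  cycle-notPath : ∀ {x y} (e : A x y) (p : Walk A y x) → ¬ IsPath (e ∷ p)
  cycle-notPath e p pp = Unique.Unique[x∷xs]⇒x∉xs pp (target∈vertices p)

  length-vertices : ∀ {x y} (p : Walk A x y) → length (vertices p) ≡ suc (walkLength p)
  length-vertices []      = refl
  length-vertices (_ ∷ p) = cong suc (length-vertices p)

  path-length< : ∀ {x y} {p : Walk A x y} → IsPath p → walkLength p ℕ.< m
  path-length< {p = p} pp = subst (ℕ._≤ m) (length-vertices p) (Unique-length≤ pp)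

  _∷ʳ_ : ∀ {x y z} → Walk A x y → A y z → Walk A x z
  []      ∷ʳ e = e ∷ []
  (f ∷ p) ∷ʳ e = f ∷ (p ∷ʳ e)

  vertices-∷ʳ : ∀ {x y z} (p : Walk A x y) (e : A y z) → vertices (p ∷ʳ e) ≡ vertices p ++ [ z ]
  vertices-∷ʳ []      e = refl
  vertices-∷ʳ (f ∷ p) e = cong (_ ∷_) (vertices-∷ʳ p e)

  module _ (A-sym : ∀ {x y} → A x y → A y x) where

    reverse : ∀ {x y} → Walk A x y → Walk A y x
    reverse []      = []
    reverse (e ∷ p) = reverse p ∷ʳ A-sym e

    vertices-reverse : ∀ {x y} (p : Walk A x y) → vertices (reverse p) ≡ List.reverse (vertices p)
    vertices-reverse []          = refl
    vertices-reverse {x} (e ∷ p) = begin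
      vertices (reverse p ∷ʳ A-sym e)     ≡⟨ vertices-∷ʳ (reverse p) (A-sym e) ⟩
      vertices (reverse p) ++ [ x ]       ≡⟨ cong (_++ [ x ]) (vertices-reverse p) ⟩
      List.reverse (vertices p) ++ [ x ]  ≡⟨ unfold-reverse x (vertices p) ⟨
      List.reverse (x ∷ vertices p)       ∎
      where open ≡.≡-Reasoning

    reverse-isPath : ∀ {x y} {p : Walk A x y} → IsPath p → IsPath (reverse p)
    reverse-isPath {p = p} pp = subst Unique (≡.sym (vertices-reverse p)) (Unique-reverse pp)

  suffixFrom : ∀ {x y z} (p : Walk A x y) → IsPath p → z ∈ vertices p → Σ (Walk A z y) IsPath
  suffixFrom []      pp       (here refl) = [] , pp
  suffixFrom []      _        (there ())
  suffixFrom (e ∷ p) pp       (here refl) = e ∷ p , pp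
  suffixFrom (e ∷ p) (_ ∷ pp) (there z∈p) = suffixFrom p pp z∈p

  toPath : ∀ {x y} → Walk A x y → Σ (Walk A x y) IsPath
  toPath []          = [] , [] ∷ []
  toPath {x} (e ∷ p) with toPath p
  ... | q , qp with any? (x ≟_) (vertices q)
  ...   | yes x∈q = suffixFrom q qp x∈q
  ...   | no  x∉q = e ∷ q , ¬Any⇒All¬ (vertices q) x∉q ∷ qp

open Walks public

module Trees {m : ℕ} (T : WeightedTree m) where

  walkWeight-∷ʳ : ∀ {x y z} (p : Walk (TAdj T) x y) (e : TAdj T y z) →
                  walkWeight T (p ∷ʳ e) ≡ walkWeight T p + weight T y z
  walkWeight-∷ʳ {x} {_} {z} []              e = ℚ.+-comm (weight T x z) 0ℚ
  walkWeight-∷ʳ {x} {_} {z} (_∷_ {y = y} _ p) e =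
    trans (cong (weight T x y +_) (walkWeight-∷ʳ p e)) (≡.sym (ℚ.+-assoc (weight T x y) (walkWeight T p) _))

  walkWeight-reverse : ∀ {x y} (p : Walk (TAdj T) x y) →
                       walkWeight T (reverse (tsym T) p) ≡ walkWeight T p
  walkWeight-reverse []                    = refl
  walkWeight-reverse {x} (_∷_ {y = y} e p) = begin
    walkWeight T (reverse (tsym T) p ∷ʳ tsym T e)     ≡⟨ walkWeight-∷ʳ (reverse (tsym T) p) (tsym T e) ⟩
    walkWeight T (reverse (tsym T) p) + weight T y x  ≡⟨ cong₂ _+_ (walkWeight-reverse p) (wsym T y x) ⟩
    walkWeight T p + weight T x y                     ≡⟨ ℚ.+-comm (walkWeight T p) (weight T x y) ⟩
    weight T x y + walkWeight T p                     ∎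
    where open ≡.≡-Reasoning

  dist-sym : ∀ {a b d} → TreeDist T a b d → TreeDist T b a d
  dist-sym (p , pp , refl) = reverse (tsym T) p , reverse-isPath (tsym T) pp , walkWeight-reverse p

  dist-sym⇔ : ∀ {a b d} → TreeDist T a b d ⇔ TreeDist T b a d
  dist-sym⇔ = mk⇔ dist-sym dist-sym

  dist-resp : ∀ {a a′ b b′ d} → a ≡ a′ → b ≡ b′ → TreeDist T a b d ⇔ TreeDist T a′ b′ d
  dist-resp refl refl = mk⇔ id id

  dist-self : ∀ {a d} → TreeDist T a a d → d ≡ 0ℚ
  dist-self ([]    , _  , refl) = refl
  dist-self (e ∷ p , pp , _)    = ⊥-elim (cycle-notPath e p pp)

  walkWeight-nonneg : ∀ {x y} (p : Walk (TAdj T) x y) → 0ℚ ≤ walkWeight T p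
  walkWeight-nonneg []                    = ℚ.≤-refl
  walkWeight-nonneg {x} (_∷_ {y = y} _ p) = ℚ.+-mono-≤ (wnonneg T x y) (walkWeight-nonneg p)

  dist-nonneg : ∀ {a b d} → TreeDist T a b d → 0ℚ ≤ d
  dist-nonneg (p , _ , refl) = walkWeight-nonneg p

  dist-exists : ∀ a b → ∃ (TreeDist T a b)
  dist-exists a b with toPath (connected T a b)
  ... | p , pp = walkWeight T p , p , pp , refl

  neighbour : ∀ {a b} → a ≢ b → ∃ (TAdj T a)
  neighbour {a} {b} a≢b with connected T a b
  ... | []    = ⊥-elim (a≢b refl)
  ... | e ∷ _ = _ , e

  totalWeight : ℚ
  totalWeight = sum λ s → sum λ t → weight T s t

  totalWeight-nonneg : 0ℚ ≤ totalWeight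
  totalWeight-nonneg = sum-nonneg _ λ s → sum-nonneg _ (wnonneg T s)

  weight≤totalWeight : ∀ s t → weight T s t ≤ totalWeight
  weight≤totalWeight s t =
    ℚ.≤-trans (≤-sum _ (wnonneg T s) t) (≤-sum _ (λ s → sum-nonneg _ (wnonneg T s)) s)

  walkWeight≤ : ∀ {x y ℓ} (p : Walk (TAdj T) x y) → walkLength p ℕ.≤ ℓ → walkWeight T p ≤ ℓ · totalWeight
  walkWeight≤ {ℓ = ℓ} [] _ = ·-nonneg ℓ totalWeight-nonneg
  walkWeight≤ {x} (_∷_ {y = y} _ p) (s≤s len) = ℚ.+-mono-≤ (weight≤totalWeight x y) (walkWeight≤ p len)

  dist≤ : ∀ {a b d} → TreeDist T a b d → d ≤ m · totalWeight
  dist≤ (p , pp , refl) = walkWeight≤ p (ℕ.<⇒≤ (path-length< pp))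

open Trees public

-- Pendant nodes and leaf-labelled trees

-- T with a new node zero joined to suc t by an edge of weight w; the old nodes are renumbered by suc.
module Pendant {m : ℕ} (T : WeightedTree m) (t : Fin m) (w : ℚ) (0≤w : 0ℚ ≤ w) where

  Adjᵖ : Fin (suc m) → Fin (suc m) → Set
  Adjᵖ zero    zero    = ⊥
  Adjᵖ zero    (suc b) = b ≡ t
  Adjᵖ (suc a) zero    = a ≡ t
  Adjᵖ (suc a) (suc b) = TAdj T a b

  Adjᵖ-sym : ∀ {x y} → Adjᵖ x y → Adjᵖ y x
  Adjᵖ-sym {zero}  {suc _} e = e
  Adjᵖ-sym {suc _} {zero}  e = e
  Adjᵖ-sym {suc _} {suc _} e = tsym T e

  Adjᵖ-irrefl : ∀ {x} → ¬ Adjᵖ x x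
  Adjᵖ-irrefl {suc _} e = tirrefl T e

  weightᵖ : Fin (suc m) → Fin (suc m) → ℚ
  weightᵖ (suc a) (suc b) = weight T a b
  weightᵖ _       _       = w

  weightᵖ-sym : ∀ x y → weightᵖ x y ≡ weightᵖ y x
  weightᵖ-sym zero    zero    = refl
  weightᵖ-sym zero    (suc _) = refl
  weightᵖ-sym (suc _) zero    = refl
  weightᵖ-sym (suc a) (suc b) = wsym T a b

  weightᵖ-nonneg : ∀ x y → 0ℚ ≤ weightᵖ x y
  weightᵖ-nonneg zero    _       = 0≤w
  weightᵖ-nonneg (suc _) zero    = 0≤w
  weightᵖ-nonneg (suc a) (suc b) = wnonneg T a b

  lift : ∀ {a b} → Walk (TAdj T) a b → Walk Adjᵖ (suc a) (suc b)
  lift []      = []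
  lift (e ∷ p) = e ∷ lift p

  vertices-lift : ∀ {a b} (p : Walk (TAdj T) a b) → vertices (lift p) ≡ map suc (vertices p)
  vertices-lift []      = refl
  vertices-lift (_ ∷ p) = cong (_ ∷_) (vertices-lift p)

  walkLength-lift : ∀ {a b} (p : Walk (TAdj T) a b) → walkLength (lift p) ≡ walkLength p
  walkLength-lift []      = refl
  walkLength-lift (_ ∷ p) = cong suc (walkLength-lift p)

  lift-isPath : ∀ {a b} {p : Walk (TAdj T) a b} → IsPath p → IsPath (lift p)
  lift-isPath {p = p} pp = subst Unique (≡.sym (vertices-lift p)) (Unique.map⁺ suc-injective pp)

  lift-isPath⁻ : ∀ {a b} (p : Walk (TAdj T) a b) → IsPath (lift p) → IsPath p
  lift-isPath⁻ p pp = Unique.map⁻ (subst Unique (vertices-lift p) pp)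

  zero∉lift : ∀ {a b} (p : Walk (TAdj T) a b) → All (zero ≢_) (vertices (lift p))
  zero∉lift []      = 0≢1+n ∷ []
  zero∉lift (_ ∷ p) = 0≢1+n ∷ zero∉lift p

  -- The new node is a leaf hanging from suc t, so a path between old nodes cannot pass through it.
  unlift : ∀ {a b} (p : Walk Adjᵖ (suc a) (suc b)) → IsPath p → Σ (Walk (TAdj T) a b) λ q → lift q ≡ p
  unlift []                       _        = [] , refl
  unlift (_∷_ {y = suc _} e p)    (_ ∷ pp) with unlift p pp
  ... | q , refl = e ∷ q , refl
  unlift (_∷_ {y = zero} refl (_∷_ {y = suc _} refl p)) pp =
    ⊥-elim (Unique.Unique[x∷xs]⇒x∉xs pp (there (source∈vertices p)))

  attachment∈vertices : ∀ {a} (p : Walk Adjᵖ (suc a) zero) → suc t ∈ vertices p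
  attachment∈vertices (_∷_ {y = zero}  refl _) = here refl
  attachment∈vertices (_∷_ {y = suc _} _    p) = there (attachment∈vertices p)

  connectedᵖ : ∀ x y → Walk Adjᵖ x y
  connectedᵖ zero    zero    = []
  connectedᵖ zero    (suc b) = refl ∷ lift (connected T t b)
  connectedᵖ (suc a) zero    = lift (connected T a t) ∷ʳ refl
  connectedᵖ (suc a) (suc b) = lift (connected T a b)

  acyclicᵖ : ∀ x y → Adjᵖ x y → (p : Walk Adjᵖ y x) → IsPath p → 2 ℕ.≤ walkLength p → ⊥
  acyclicᵖ zero (suc _) refl (_∷_ {y = zero} _ [])        _        (s≤s ())
  acyclicᵖ zero (suc _) refl (_∷_ {y = zero} _ (e ∷ p))   (_ ∷ pp) _ = cycle-notPath e p pp
  acyclicᵖ zero (suc _) refl (_∷_ {y = suc _} _ p)        pp       _ =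
    Unique.Unique[x∷xs]⇒x∉xs pp (attachment∈vertices p)
  acyclicᵖ (suc _) zero refl (_∷_ {y = suc _} refl [])       _        (s≤s ())
  acyclicᵖ (suc _) zero refl (_∷_ {y = suc _} refl (e ∷ p))  (_ ∷ pp) _ = cycle-notPath e p pp
  acyclicᵖ (suc a) (suc b) e p pp len with unlift p pp
  ... | q , refl = acyclic T a b e q (lift-isPath⁻ q pp) (subst (2 ℕ.≤_) (walkLength-lift q) len)

  pendant : WeightedTree (suc m)
  pendant = record
    { TAdj      = Adjᵖ
    ; tsym      = λ {x} {y} → Adjᵖ-sym {x} {y}
    ; tirrefl   = λ {x} → Adjᵖ-irrefl {x}
    ; connected = connectedᵖ
    ; acyclic   = acyclicᵖ
    ; weight    = weightᵖ
    ; wsym      = weightᵖ-sym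
    ; wnonneg   = weightᵖ-nonneg
    }

  walkWeight-lift : ∀ {a b} (p : Walk (TAdj T) a b) → walkWeight pendant (lift p) ≡ walkWeight T p
  walkWeight-lift []                    = refl
  walkWeight-lift {a} (_∷_ {y = y} _ p) = cong (weight T a y +_) (walkWeight-lift p)

  dist-suc⁺ : ∀ {a b d} → TreeDist T a b d → TreeDist pendant (suc a) (suc b) d
  dist-suc⁺ (p , pp , refl) = lift p , lift-isPath pp , walkWeight-lift p

  dist-suc⁻ : ∀ {a b d} → TreeDist pendant (suc a) (suc b) d → TreeDist T a b d
  dist-suc⁻ (p , pp , refl) with unlift p pp
  ... | q , refl = q , lift-isPath⁻ q pp , ≡.sym (walkWeight-lift q)

  dist-suc : ∀ {a b d} → TreeDist pendant (suc a) (suc b) d ⇔ TreeDist T a b d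
  dist-suc = mk⇔ dist-suc⁻ dist-suc⁺

  dist-zero⁺ : ∀ {b d} → TreeDist T t b (d - w) → TreeDist pendant zero (suc b) d
  dist-zero⁺ {d = d} (p , pp , eq) =
    refl ∷ lift p , zero∉lift p ∷ lift-isPath pp ,
    trans (cong (w +_) (trans (walkWeight-lift p) eq)) (p+[q-p]≡q w d)

  dist-zero⁻ : ∀ {b d} → TreeDist pendant zero (suc b) d → TreeDist T t b (d - w)
  dist-zero⁻ (_∷_ {y = suc _} refl p , _ ∷ pp , refl) =
    subst (TreeDist T t _) (≡.sym ([p+q]-p≡q w _)) (dist-suc⁻ (p , pp , refl))

  dist-zero : ∀ {b d} → TreeDist pendant zero (suc b) d ⇔ TreeDist T t b (d - w)
  dist-zero = mk⇔ dist-zero⁻ dist-zero⁺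

  isLeaf-zero : IsLeaf pendant zero
  isLeaf-zero (suc _) (suc _) refl refl = refl

  isLeaf-suc⁺ : ∀ {s} → IsLeaf T s → s ≢ t → IsLeaf pendant (suc s)
  isLeaf-suc⁺ s-leaf s≢t zero    _       e _ = ⊥-elim (s≢t e)
  isLeaf-suc⁺ s-leaf s≢t (suc _) zero    _ e = ⊥-elim (s≢t e)
  isLeaf-suc⁺ s-leaf s≢t (suc a) (suc b) e f = cong suc (s-leaf a b e f)

  isLeaf-suc⁻ : ∀ {s} → IsLeaf pendant (suc s) → IsLeaf T s
  isLeaf-suc⁻ s-leaf a b e f = suc-injective (s-leaf (suc a) (suc b) e f)

  attachment-notLeaf : ∀ {c} → TAdj T t c → ¬ IsLeaf pendant (suc t)
  attachment-notLeaf {c} e t-leaf = 0≢1+n (t-leaf zero (suc c) refl e)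

record LabelledTree (n : ℕ) : Set₁ where
  constructor labelled
  field
    {size}    : ℕ
    tree      : WeightedTree size
    labelling : LeafBijection {n} tree

  node : Fin n → Fin size
  node = leaf labelling

  LeafDist : Fin n → Fin n → ℚ → Set
  LeafDist y z = TreeDist tree (node y) (node z)

open LabelledTree public

-- The label v moves to the new node; e keeps the old node of v from becoming an unlabelled leaf.
module ExtendLeaf {n} (𝒯 : LabelledTree n) (v : Fin n) (w : ℚ) (0≤w : 0ℚ ≤ w)
                  {c} (e : TAdj (tree 𝒯) (node 𝒯 v) c) where
  open Pendant (tree 𝒯) (node 𝒯 v) w 0≤w

  node′ : Fin n → Fin (suc (size 𝒯))
  node′ = updateAt (suc ∘ node 𝒯) v λ _ → zero

  node′-v : node′ v ≡ zero
  node′-v = updateAt-updates v (suc ∘ node 𝒯)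

  node′-other : ∀ {y} → y ≢ v → node′ y ≡ suc (node 𝒯 y)
  node′-other y≢v = updateAt-minimal _ v (suc ∘ node 𝒯) y≢v

  node′-injective : ∀ y z → node′ y ≡ node′ z → y ≡ z
  node′-injective y z eq with y ≟ v | z ≟ v
  ... | yes refl | yes refl = refl
  ... | yes refl | no z≢v   = ⊥-elim (0≢1+n (trans (≡.sym node′-v) (trans eq (node′-other z≢v))))
  ... | no y≢v   | yes refl = ⊥-elim (0≢1+n (trans (≡.sym node′-v) (trans (≡.sym eq) (node′-other y≢v))))
  ... | no y≢v   | no z≢v   = injective (labelling 𝒯) y z
    (suc-injective (trans (≡.sym (node′-other y≢v)) (trans eq (node′-other z≢v))))

  node′-isLeaf : ∀ y → IsLeaf pendant (node′ y)
  node′-isLeaf y with y ≟ v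
  ... | yes refl = subst (IsLeaf pendant) (≡.sym node′-v) isLeaf-zero
  ... | no y≢v   = subst (IsLeaf pendant) (≡.sym (node′-other y≢v))
    (isLeaf-suc⁺ (isLeaf (labelling 𝒯) y) (y≢v ∘ injective (labelling 𝒯) y v))

  node′-surjective : ∀ s → IsLeaf pendant s → ∃ λ y → node′ y ≡ s
  node′-surjective zero    _      = v , node′-v
  node′-surjective (suc s) s-leaf with surjective (labelling 𝒯) s (isLeaf-suc⁻ s-leaf)
  ... | y , refl with y ≟ v
  ...   | yes refl = ⊥-elim (attachment-notLeaf e s-leaf)
  ...   | no y≢v   = y , node′-other y≢v

  extendLeaf : LabelledTree n
  extendLeaf = labelled pendant record
    { leaf = node′ ; injective = node′-injective ; isLeaf = node′-isLeaf ; surjective = node′-surjective }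

  extendLeaf-dist : ∀ {y z d} → y ≢ v → z ≢ v → LeafDist extendLeaf y z d ⇔ LeafDist 𝒯 y z d
  extendLeaf-dist {y} {z} {d} y≢v z≢v = begin
    TreeDist pendant (node′ y) (node′ z) d                ≈⟨ dist-resp pendant (node′-other y≢v) (node′-other z≢v) ⟩
    TreeDist pendant (suc (node 𝒯 y)) (suc (node 𝒯 z)) d  ≈⟨ dist-suc ⟩
    LeafDist 𝒯 y z d                                       ∎
    where open ⇔-Reasoning

  extendLeaf-dist-v : ∀ {z d} → z ≢ v → LeafDist extendLeaf v z d ⇔ LeafDist 𝒯 v z (d - w)
  extendLeaf-dist-v {z} {d} z≢v = begin
    TreeDist pendant (node′ v) (node′ z) d    ≈⟨ dist-resp pendant node′-v (node′-other z≢v) ⟩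
    TreeDist pendant zero (suc (node 𝒯 z)) d  ≈⟨ dist-zero ⟩
    LeafDist 𝒯 v z (d - w)                     ∎
    where open ⇔-Reasoning

module AttachLeaf {n} (𝒯 : LabelledTree n) (t : Fin (size 𝒯)) (t-notLeaf : ¬ IsLeaf (tree 𝒯) t)
                  (w : ℚ) (0≤w : 0ℚ ≤ w) (u : Fin (suc n)) where
  open Pendant (tree 𝒯) t w 0≤w

  node′ : Fin (suc n) → Fin (suc (size 𝒯))
  node′ = insertAt (suc ∘ node 𝒯) u zero

  node′-u : node′ u ≡ zero
  node′-u = insertAt-lookup (suc ∘ node 𝒯) u zero

  node′-punchIn : ∀ y → node′ (punchIn u y) ≡ suc (node 𝒯 y)
  node′-punchIn = insertAt-punchIn (suc ∘ node 𝒯) u zero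

  node′-injective : ∀ y z → node′ y ≡ node′ z → y ≡ z
  node′-injective y z eq with punchView u y | punchView u z
  ... | pivot      | pivot      = refl
  ... | pivot      | punched z′ = ⊥-elim (0≢1+n (trans (≡.sym node′-u) (trans eq (node′-punchIn z′))))
  ... | punched y′ | pivot      = ⊥-elim (0≢1+n (trans (≡.sym node′-u) (trans (≡.sym eq) (node′-punchIn y′))))
  ... | punched y′ | punched z′ = cong (punchIn u) (injective (labelling 𝒯) y′ z′
    (suc-injective (trans (≡.sym (node′-punchIn y′)) (trans eq (node′-punchIn z′)))))

  node′-isLeaf : ∀ y → IsLeaf pendant (node′ y)
  node′-isLeaf y with punchView u y
  ... | pivot      = subst (IsLeaf pendant) (≡.sym node′-u) isLeaf-zero
  ... | punched y′ = subst (IsLeaf pendant) (≡.sym (node′-punchIn y′))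
    (isLeaf-suc⁺ (isLeaf (labelling 𝒯) y′) λ { refl → t-notLeaf (isLeaf (labelling 𝒯) y′) })

  node′-surjective : ∀ s → IsLeaf pendant s → ∃ λ y → node′ y ≡ s
  node′-surjective zero    _      = u , node′-u
  node′-surjective (suc s) s-leaf with surjective (labelling 𝒯) s (isLeaf-suc⁻ s-leaf)
  ... | y , refl = punchIn u y , node′-punchIn y

  attachLeaf : LabelledTree (suc n)
  attachLeaf = labelled pendant record
    { leaf = node′ ; injective = node′-injective ; isLeaf = node′-isLeaf ; surjective = node′-surjective }

  attachLeaf-dist : ∀ y z {d} → LeafDist attachLeaf (punchIn u y) (punchIn u z) d ⇔ LeafDist 𝒯 y z d
  attachLeaf-dist y z {d} = begin
    TreeDist pendant (node′ (punchIn u y)) (node′ (punchIn u z)) d  ≈⟨ dist-resp pendant (node′-punchIn y)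
                                                                                         (node′-punchIn z) ⟩
    TreeDist pendant (suc (node 𝒯 y)) (suc (node 𝒯 z)) d            ≈⟨ dist-suc ⟩
    LeafDist 𝒯 y z d                                                 ∎
    where open ⇔-Reasoning

  attachLeaf-dist-u : ∀ y {d} →
                      LeafDist attachLeaf u (punchIn u y) d ⇔ TreeDist (tree 𝒯) t (node 𝒯 y) (d - w)
  attachLeaf-dist-u y {d} = begin
    TreeDist pendant (node′ u) (node′ (punchIn u y)) d  ≈⟨ dist-resp pendant node′-u (node′-punchIn y) ⟩
    TreeDist pendant zero (suc (node 𝒯 y)) d            ≈⟨ dist-zero ⟩
    TreeDist (tree 𝒯) t (node 𝒯 y) (d - w)              ∎
    where open ⇔-Reasoning

neighbourOfLeaf : ∀ {n} (𝒯 : LabelledTree n) {y z} → y ≢ z → ∃ (TAdj (tree 𝒯) (node 𝒯 y))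
neighbourOfLeaf 𝒯 y≢z = neighbour (tree 𝒯) (y≢z ∘ injective (labelling 𝒯) _ _)

-- Lengthening pendant edges

-- 𝒯 is 𝒯₀ with the pendant edge of every leaf y lengthened by c y.
record Shifted {n} (𝒯₀ : LabelledTree n) (c : Fin n → ℚ) (𝒯 : LabelledTree n) : Set where
  constructor shifted
  field
    shifted-dist : ∀ {y z d} → y ≢ z → LeafDist 𝒯 y z d ⇔ LeafDist 𝒯₀ y z (d - (c y + c z))

open Shifted public

shifted-refl : ∀ {n} {𝒯 : LabelledTree n} → Shifted 𝒯 (λ _ → 0ℚ) 𝒯
shifted-refl {𝒯 = 𝒯} = shifted λ {y} {z} {d} _ → begin
  LeafDist 𝒯 y z d                   ≡⟨ cong (LeafDist 𝒯 y z) (p≡p-[0+0] d) ⟩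
  LeafDist 𝒯 y z (d - (0ℚ + 0ℚ))     ∎
  where
  open ⇔-Reasoning
  p≡p-[0+0] : ∀ p → p ≡ p - (0ℚ + 0ℚ)
  p≡p-[0+0] = solve-∀ ℚ-ring

shifted-cong : ∀ {n} {𝒯₀ 𝒯 : LabelledTree n} {c c′} →
               (∀ y → c y ≡ c′ y) → Shifted 𝒯₀ c 𝒯 → Shifted 𝒯₀ c′ 𝒯
shifted-cong {𝒯₀ = 𝒯₀} {𝒯} {c} {c′} c≡c′ sh = shifted λ {y} {z} {d} y≢z → begin
  LeafDist 𝒯 y z d                     ≈⟨ shifted-dist sh y≢z ⟩
  LeafDist 𝒯₀ y z (d - (c y + c z))    ≡⟨ cong (λ s → LeafDist 𝒯₀ y z (d - s))
                                             (cong₂ _+_ (c≡c′ y) (c≡c′ z)) ⟩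
  LeafDist 𝒯₀ y z (d - (c′ y + c′ z))  ∎
  where open ⇔-Reasoning

module _ {n} {𝒯₀ 𝒯 : LabelledTree n} {c : Fin n → ℚ} (sh : Shifted 𝒯₀ c 𝒯)
         (v : Fin n) (w : ℚ) (0≤w : 0ℚ ≤ w) {a} (e : TAdj (tree 𝒯) (node 𝒯 v) a) where
  open ExtendLeaf 𝒯 v w 0≤w e

  private
    c′ : Fin n → ℚ
    c′ = updateAt c v (w +_)

    c′-v : c′ v ≡ w + c v
    c′-v = updateAt-updates v c

    c′-other : ∀ {y} → y ≢ v → c′ y ≡ c y
    c′-other y≢v = updateAt-minimal _ v c y≢v

    shiftˡ : ∀ d w a b → d - w - (a + b) ≡ d - (w + a + b)
    shiftˡ = solve-∀ ℚ-ring

    shiftʳ : ∀ d w a b → d - w - (a + b) ≡ d - (a + (w + b))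
    shiftʳ = solve-∀ ℚ-ring

  open ⇔-Reasoning

  extendLeaf-shifted : Shifted 𝒯₀ (updateAt c v (w +_)) extendLeaf
  extendLeaf-shifted = shifted extendLeaf-dist-shifted
    where
    extendLeaf-dist-shifted : ∀ {y z d} → y ≢ z →
                              LeafDist extendLeaf y z d ⇔ LeafDist 𝒯₀ y z (d - (c′ y + c′ z))
    extendLeaf-dist-shifted {y} {z} {d} y≢z with y ≟ v | z ≟ v
    ... | yes refl | yes refl = ⊥-elim (y≢z refl)
    ... | no y≢v   | no z≢v   = begin
      LeafDist extendLeaf y z d                ≈⟨ extendLeaf-dist y≢v z≢v ⟩
      LeafDist 𝒯 y z d                         ≈⟨ shifted-dist sh y≢z ⟩
      LeafDist 𝒯₀ y z (d - (c y + c z))        ≡⟨ cong (λ s → LeafDist 𝒯₀ y z (d - s))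
                                                    (cong₂ _+_ (c′-other y≢v) (c′-other z≢v)) ⟨
      LeafDist 𝒯₀ y z (d - (c′ y + c′ z))      ∎
    ... | yes refl | no z≢v   = begin
      LeafDist extendLeaf v z d                ≈⟨ extendLeaf-dist-v z≢v ⟩
      LeafDist 𝒯 v z (d - w)                   ≈⟨ shifted-dist sh y≢z ⟩
      LeafDist 𝒯₀ v z (d - w - (c v + c z))    ≡⟨ cong (LeafDist 𝒯₀ v z) (shiftˡ d w (c v) (c z)) ⟩
      LeafDist 𝒯₀ v z (d - (w + c v + c z))    ≡⟨ cong (λ s → LeafDist 𝒯₀ v z (d - s))
                                                    (cong₂ _+_ c′-v (c′-other z≢v)) ⟨
      LeafDist 𝒯₀ v z (d - (c′ v + c′ z))      ∎
    ... | no y≢v   | yes refl = begin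
      LeafDist extendLeaf y v d                ≈⟨ dist-sym⇔ (tree extendLeaf) ⟩
      LeafDist extendLeaf v y d                ≈⟨ extendLeaf-dist-v y≢v ⟩
      LeafDist 𝒯 v y (d - w)                   ≈⟨ dist-sym⇔ (tree 𝒯) ⟩
      LeafDist 𝒯 y v (d - w)                   ≈⟨ shifted-dist sh y≢z ⟩
      LeafDist 𝒯₀ y v (d - w - (c y + c v))    ≡⟨ cong (LeafDist 𝒯₀ y v) (shiftʳ d w (c y) (c v)) ⟩
      LeafDist 𝒯₀ y v (d - (c y + (w + c v)))  ≡⟨ cong (λ s → LeafDist 𝒯₀ y v (d - s))
                                                    (cong₂ _+_ (c′-other y≢v) c′-v) ⟨
      LeafDist 𝒯₀ y v (d - (c′ y + c′ v))      ∎

module Lengthen {k} (𝒯₀ : LabelledTree (suc (suc k))) (c : Fin (suc (suc k)) → ℚ) (0≤c : ∀ y → 0ℚ ≤ c y) where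

  restrict : List (Fin (suc (suc k))) → Fin (suc (suc k)) → ℚ
  restrict []       = λ _ → 0ℚ
  restrict (v ∷ vs) = updateAt (restrict vs) v (c v +_)

  restrict-∉ : ∀ {y} vs → y ∉ vs → restrict vs y ≡ 0ℚ
  restrict-∉ []       _   = refl
  restrict-∉ (v ∷ vs) y∉ = trans (updateAt-minimal _ v _ (y∉ ∘ here)) (restrict-∉ vs (y∉ ∘ there))

  restrict-∈ : ∀ {y} vs → Unique vs → y ∈ vs → restrict vs y ≡ c y + 0ℚ
  restrict-∈ (v ∷ vs) u (here refl) =
    trans (updateAt-updates v (restrict vs)) (cong (c v +_) (restrict-∉ vs (Unique.Unique[x∷xs]⇒x∉xs u)))
  restrict-∈ (v ∷ vs) (v∉vs ∷ u) (there y∈vs) =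
    trans (updateAt-minimal _ v _ λ y≡v → All.lookup v∉vs y∈vs (≡.sym y≡v)) (restrict-∈ vs u y∈vs)

  lengthenLeaves : ∀ vs → Σ (LabelledTree (suc (suc k))) (Shifted 𝒯₀ (restrict vs))
  lengthenLeaves []       = 𝒯₀ , shifted-refl
  lengthenLeaves (v ∷ vs) with lengthenLeaves vs
  ... | 𝒯 , sh with neighbourOfLeaf 𝒯 (proj₂ (another v) ∘ ≡.sym)
  ...   | _ , e = ExtendLeaf.extendLeaf 𝒯 v (c v) (0≤c v) e , extendLeaf-shifted sh v (c v) (0≤c v) e

  lengthen : Σ (LabelledTree (suc (suc k))) (Shifted 𝒯₀ c)
  lengthen with lengthenLeaves (allFin _)
  ... | 𝒯 , sh = 𝒯 , shifted-cong restrict-allFin sh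
    where
    restrict-allFin : ∀ y → restrict (allFin _) y ≡ c y
    restrict-allFin y = trans (restrict-∈ _ (Unique.allFin⁺ _) (∈-allFin y)) (ℚ.+-identityʳ (c y))

infix 4 _∈ᴵ_
_∈ᴵ_ : ℚ → Interval → Set
q ∈ᴵ I = _∈I_ I q

translate : (s : ℚ) → 0ℚ ≤ s → Interval → Interval
translate s 0≤s I = record
  { _∈I_   = λ q → q - s ∈ᴵ I
  ; nonneg = λ q q-s∈I → subst (0ℚ ≤_) (p-q+q≡p q s) (ℚ.+-mono-≤ (nonneg I _ q-s∈I) 0≤s)
  ; convex = λ p q r p-s∈I r-s∈I p≤q q≤r →
      convex I _ _ _ p-s∈I r-s∈I (ℚ.+-monoˡ-≤ (- s) p≤q) (ℚ.+-monoˡ-≤ (- s) q≤r)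
  }
  where
  p-q+q≡p : ∀ p q → p - q + q ≡ p
  p-q+q≡p = solve-∀ ℚ-ring

_∩_ : Interval → Interval → Interval
I ∩ J = record
  { _∈I_   = λ q → q ∈ᴵ I × q ∈ᴵ J
  ; nonneg = λ q q∈ → nonneg I q (proj₁ q∈)
  ; convex = λ p q r (p∈I , p∈J) (r∈I , r∈J) p≤q q≤r →
      convex I p q r p∈I r∈I p≤q q≤r , convex J p q r p∈J r∈J p≤q q≤r
  }

atMost : ℚ → Interval
atMost b = record
  { _∈I_   = λ q → 0ℚ ≤ q × q ≤ b
  ; nonneg = λ q → proj₁
  ; convex = λ p q r (0≤p , _) (_ , r≤b) p≤q q≤r → ℚ.≤-trans 0≤p p≤q , ℚ.≤-trans q≤r r≤b
  }

atLeast : (b : ℚ) → 0ℚ ≤ b → Interval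
atLeast b 0≤b = record
  { _∈I_   = b ≤_
  ; nonneg = λ q b≤q → ℚ.≤-trans 0≤b b≤q
  ; convex = λ p q r b≤p _ p≤q _ → ℚ.≤-trans b≤p p≤q
  }

LeafDistIn : ∀ {n} → LabelledTree n → (ℚ → Set) → Fin n → Fin n → Set
LeafDistIn 𝒯 J p q = ∃ λ d → LeafDist 𝒯 p q d × J d

leafDistIn-sym : ∀ {n} {𝒯 : LabelledTree n} {J p q} → LeafDistIn 𝒯 J p q → LeafDistIn 𝒯 J q p
leafDistIn-sym {𝒯 = 𝒯} (d , h , d∈J) = d , dist-sym (tree 𝒯) h , d∈J

Realises : ∀ {n} → Graph n → LabelledTree n → (ℚ → Set) → Fin n → Fin n → Set
Realises G 𝒯 J p q = Adj G p q ⇔ LeafDistIn 𝒯 J p q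

realises-sym : ∀ {n} {G : Graph n} {𝒯 : LabelledTree n} {J p q} → Realises G 𝒯 J p q → Realises G 𝒯 J q p
realises-sym {G = G} {𝒯} r = mk⇔
  (leafDistIn-sym {𝒯 = 𝒯} ∘ Equivalence.to r ∘ sym G)
  (sym G ∘ Equivalence.from r ∘ leafDistIn-sym {𝒯 = 𝒯})

module Construction {k} (G : Graph (suc (suc (suc k)))) (u x : Fin (suc (suc (suc k))))
  (x≢u : x ≢ u) (u≁x : ¬ Adj G u x) (u∼others : ∀ y → y ≢ u → y ≢ x → Adj G u y)
  (𝒯₀ : LabelledTree (suc (suc k))) (I : Interval)
  (pcg : ∀ y z → y ≢ z → Realises (removeVertex G u) 𝒯₀ (_∈ᴵ I) y z) where

  B : ℚ
  B = size 𝒯₀ · totalWeight (tree 𝒯₀)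

  dist≤B : ∀ {y z d} → LeafDist 𝒯₀ y z d → d ≤ B
  dist≤B = dist≤ (tree 𝒯₀)

  two : ℚ
  two = 1ℚ + 1ℚ

  W : ℚ
  W = B + (two + 1ℚ)

  0≤W : 0ℚ ≤ W
  0≤W = ℚ.+-mono-≤ (·-nonneg (size 𝒯₀) (totalWeight-nonneg (tree 𝒯₀))) (ℚ.nonNegative⁻¹ _)

  x′ : Fin (suc (suc k))
  x′ = punchOut (x≢u ∘ ≡.sym)

  lengthened : Σ (LabelledTree (suc (suc k))) (Shifted 𝒯₀ λ _ → 1ℚ)
  lengthened = Lengthen.lengthen 𝒯₀ (λ _ → 1ℚ) (λ _ → ℚ.nonNegative⁻¹ _)

  𝒯₁ : LabelledTree (suc (suc k))
  𝒯₁ = proj₁ lengthened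

  t : Fin (size 𝒯₁)
  t = node 𝒯₁ x′

  t-neighbour : ∃ (TAdj (tree 𝒯₁) t)
  t-neighbour = neighbourOfLeaf 𝒯₁ (proj₂ (another x′) ∘ ≡.sym)

  module P = Pendant (tree 𝒯₁) t 0ℚ ℚ.≤-refl
  module E = ExtendLeaf 𝒯₁ x′ 0ℚ ℚ.≤-refl (proj₂ t-neighbour)

  𝒯₂ : LabelledTree (suc (suc k))
  𝒯₂ = E.extendLeaf

  shifted₂ : Shifted 𝒯₀ (λ _ → 1ℚ) 𝒯₂
  shifted₂ = shifted-cong (updateAt-id-local x′ (λ _ → 1ℚ) refl)
    (extendLeaf-shifted (proj₂ lengthened) x′ 0ℚ ℚ.≤-refl (proj₂ t-neighbour))

  module A = AttachLeaf 𝒯₂ (suc t) (P.attachment-notLeaf (proj₂ t-neighbour)) W 0≤W u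

  𝒯₃ : LabelledTree (suc (suc (suc k)))
  𝒯₃ = A.attachLeaf

  dist-old : ∀ {y z d} → y ≢ z → LeafDist 𝒯₃ (punchIn u y) (punchIn u z) d ⇔ LeafDist 𝒯₀ y z (d - two)
  dist-old {y} {z} {d} y≢z = begin
    LeafDist 𝒯₃ (punchIn u y) (punchIn u z) d  ≈⟨ A.attachLeaf-dist y z ⟩
    LeafDist 𝒯₂ y z d                          ≈⟨ shifted-dist shifted₂ y≢z ⟩
    LeafDist 𝒯₀ y z (d - two)                  ∎
    where open ⇔-Reasoning

  dist-u-x : ∀ {d} → LeafDist 𝒯₃ u (punchIn u x′) d ⇔ TreeDist (tree 𝒯₁) t t (d - W - 0ℚ)
  dist-u-x {d} = begin
    LeafDist 𝒯₃ u (punchIn u x′) d                   ≈⟨ A.attachLeaf-dist-u x′ ⟩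
    TreeDist (tree 𝒯₂) (suc t) (E.node′ x′) (d - W)  ≈⟨ dist-resp (tree 𝒯₂) refl E.node′-v ⟩
    TreeDist (tree 𝒯₂) (suc t) zero (d - W)          ≈⟨ dist-sym⇔ (tree 𝒯₂) ⟩
    TreeDist (tree 𝒯₂) zero (suc t) (d - W)          ≈⟨ P.dist-zero ⟩
    TreeDist (tree 𝒯₁) t t (d - W - 0ℚ)              ∎
    where open ⇔-Reasoning

  dist-u : ∀ {y d} → y ≢ x′ → LeafDist 𝒯₃ u (punchIn u y) d ⇔ LeafDist 𝒯₀ x′ y (d - W - two)
  dist-u {y} {d} y≢x′ = begin
    LeafDist 𝒯₃ u (punchIn u y) d                         ≈⟨ A.attachLeaf-dist-u y ⟩
    TreeDist (tree 𝒯₂) (suc t) (E.node′ y) (d - W)        ≈⟨ dist-resp (tree 𝒯₂) refl (E.node′-other y≢x′) ⟩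
    TreeDist (tree 𝒯₂) (suc t) (suc (node 𝒯₁ y)) (d - W)  ≈⟨ P.dist-suc ⟩
    LeafDist 𝒯₁ x′ y (d - W)                               ≈⟨ shifted-dist (proj₂ lengthened) (y≢x′ ∘ ≡.sym) ⟩
    LeafDist 𝒯₀ x′ y (d - W - two)                         ∎
    where open ⇔-Reasoning

  I₁ : Interval
  I₁ = translate two (ℚ.nonNegative⁻¹ _) (I ∩ atMost B)

  I₂ : Interval
  I₂ = atLeast (W + two) (ℚ.+-mono-≤ 0≤W (ℚ.nonNegative⁻¹ _))

  InI : ℚ → Set
  InI d = d ∈ᴵ I₁ ⊎ d ∈ᴵ I₂

  I₂-beyond-B : ∀ {d} → d ∈ᴵ I₂ → ¬ (d - two ≤ B)
  I₂-beyond-B {d} W+2≤d d-2≤B = p+q≰p (ℚ.positive⁻¹ (two + 1ℚ)) (ℚ.≤-trans W≤d-2 d-2≤B)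
    where
    W≤d-2 : W ≤ d - two
    W≤d-2 = subst (_≤ d - two) ([p+q]-q≡p W two) (ℚ.+-monoˡ-≤ (- two) W+2≤d)

  I₁-I₂-disjoint : Disjoint I₁ I₂
  I₁-I₂-disjoint d (_ , _ , d-2≤B) d∈I₂ = I₂-beyond-B d∈I₂ d-2≤B

  W∉I : ¬ InI W
  W∉I (inj₁ (_ , _ , W-2≤B)) = p+q≰p (ℚ.positive⁻¹ 1ℚ) (subst (_≤ B) (W-2≡B+1 B) W-2≤B)
    where
    W-2≡B+1 : ∀ B → B + ((1ℚ + 1ℚ) + 1ℚ) - (1ℚ + 1ℚ) ≡ B + 1ℚ
    W-2≡B+1 = solve-∀ ℚ-ring
  W∉I (inj₂ W+2≤W) = p+q≰p (ℚ.positive⁻¹ two) W+2≤W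

  old-pair⁺ : ∀ {y z} → y ≢ z →
              LeafDistIn 𝒯₀ (_∈ᴵ I) y z → LeafDistIn 𝒯₃ InI (punchIn u y) (punchIn u z)
  old-pair⁺ {y} {z} y≢z (d₀ , h₀ , d₀∈I) =
    two + d₀ ,
    Equivalence.from (dist-old y≢z) (subst (LeafDist 𝒯₀ y z) (≡.sym 2+d₀-2≡d₀) h₀) ,
    inj₁ (subst (_∈ᴵ I ∩ atMost B) (≡.sym 2+d₀-2≡d₀) (d₀∈I , dist-nonneg (tree 𝒯₀) h₀ , dist≤B h₀))
    where
    2+d₀-2≡d₀ : two + d₀ - two ≡ d₀
    2+d₀-2≡d₀ = [p+q]-p≡q two d₀

  old-pair⁻ : ∀ {y z} → y ≢ z →
              LeafDistIn 𝒯₃ InI (punchIn u y) (punchIn u z) → LeafDistIn 𝒯₀ (_∈ᴵ I) y z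
  old-pair⁻ y≢z (d , h , inj₁ (d-2∈I , _)) = d - two , Equivalence.to (dist-old y≢z) h , d-2∈I
  old-pair⁻ y≢z (d , h , inj₂ d∈I₂)        =
    ⊥-elim (I₂-beyond-B d∈I₂ (dist≤B (Equivalence.to (dist-old y≢z) h)))

  old-pair : ∀ {y z} → y ≢ z → Realises G 𝒯₃ InI (punchIn u y) (punchIn u z)
  old-pair {y} {z} y≢z = begin
    Adj G (punchIn u y) (punchIn u z)                ≈⟨ pcg y z y≢z ⟩
    LeafDistIn 𝒯₀ (_∈ᴵ I) y z                         ≈⟨ mk⇔ (old-pair⁺ y≢z) (old-pair⁻ y≢z) ⟩
    LeafDistIn 𝒯₃ InI (punchIn u y) (punchIn u z)    ∎
    where open ⇔-Reasoning

  u-x-far : ¬ LeafDistIn 𝒯₃ InI u (punchIn u x′)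
  u-x-far (d , h , d∈I) = W∉I (subst InI d≡W d∈I)
    where
    d≡W+[d-W-0] : ∀ d W → d ≡ W + (d - W - 0ℚ)
    d≡W+[d-W-0] = solve-∀ ℚ-ring
    d≡W : d ≡ W
    d≡W = begin
      d                    ≡⟨ d≡W+[d-W-0] d W ⟩
      W + (d - W - 0ℚ)     ≡⟨ cong (W +_) (dist-self (tree 𝒯₁) (Equivalence.to dist-u-x h)) ⟩
      W + 0ℚ               ≡⟨ ℚ.+-identityʳ W ⟩
      W                    ∎
      where open ≡.≡-Reasoning

  u-x-pair : Realises G 𝒯₃ InI u (punchIn u x′)
  u-x-pair = mk⇔ (⊥-elim ∘ u≁x ∘ subst (Adj G u) (punchIn-punchOut (x≢u ∘ ≡.sym))) (⊥-elim ∘ u-x-far)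

  u-other-near : ∀ {y} → y ≢ x′ → ∃ (LeafDist 𝒯₀ x′ y) → LeafDistIn 𝒯₃ InI u (punchIn u y)
  u-other-near {y} y≢x′ (d₀ , h₀) =
    W + (two + d₀) ,
    Equivalence.from (dist-u y≢x′) (subst (LeafDist 𝒯₀ x′ y) (≡.sym (W+[2+d₀]-W-2≡d₀ W d₀)) h₀) ,
    inj₂ (ℚ.+-monoʳ-≤ W (p≤p+q (dist-nonneg (tree 𝒯₀) h₀)))
    where
    W+[2+d₀]-W-2≡d₀ : ∀ W d₀ → W + (two + d₀) - W - two ≡ d₀
    W+[2+d₀]-W-2≡d₀ = solve-∀ ℚ-ring

  u-other-pair : ∀ {y} → y ≢ x′ → Realises G 𝒯₃ InI u (punchIn u y)
  u-other-pair {y} y≢x′ = mk⇔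
    (λ _ → u-other-near y≢x′ (dist-exists (tree 𝒯₀) (node 𝒯₀ x′) (node 𝒯₀ y)))
    (λ _ → u∼others (punchIn u y) (punchInᵢ≢i u y)
                    (y≢x′ ∘ punchIn-injective u y x′ ∘ punchIn-y≡punchIn-x′))
    where
    punchIn-y≡punchIn-x′ : punchIn u y ≡ x → punchIn u y ≡ punchIn u x′
    punchIn-y≡punchIn-x′ eq = trans eq (≡.sym (punchIn-punchOut (x≢u ∘ ≡.sym)))

  u-pair : ∀ {y} → Dec (y ≡ x′) → Realises G 𝒯₃ InI u (punchIn u y)
  u-pair (yes refl) = u-x-pair
  u-pair (no y≢x′)  = u-other-pair y≢x′

  realises : ∀ {p q} → PunchView u p → PunchView u q → p ≢ q → Realises G 𝒯₃ InI p q
  realises pivot       pivot       p≢q = ⊥-elim (p≢q refl)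
  realises pivot       (punched z) _   = u-pair (z ≟ x′)
  realises (punched y) pivot       _   = realises-sym {G = G} {𝒯₃} (u-pair (y ≟ x′))
  realises (punched y) (punched z) p≢q = old-pair (p≢q ∘ cong (punchIn u))

  is2IntervalPCG : Is2IntervalPCG G
  is2IntervalPCG =
    _ , tree 𝒯₃ , labelling 𝒯₃ , I₁ , I₂ , I₁-I₂-disjoint , λ p q → realises (punchView u p) (punchView u q)

point : WeightedTree 1
point = record
  { TAdj      = λ _ _ → ⊥
  ; tsym      = λ ()
  ; tirrefl   = λ ()
  ; connected = λ { zero zero → [] }
  ; acyclic   = λ _ _ ()
  ; weight    = λ _ _ → 0ℚ
  ; wsym      = λ _ _ → refl
  ; wnonneg   = λ _ _ → ℚ.≤-refl
  }

module Edge = Pendant point zero 0ℚ ℚ.≤-refl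

edge-isLeaf : ∀ s → IsLeaf Edge.pendant s
edge-isLeaf zero                     = Edge.isLeaf-zero
edge-isLeaf (suc zero) zero zero _ _ = refl

edge : LabelledTree 2
edge = labelled Edge.pendant record
  { leaf = λ s → s ; injective = λ _ _ eq → eq ; isLeaf = edge-isLeaf ; surjective = λ s _ → s , refl }

∅ᴵ : Interval
∅ᴵ = record { _∈I_ = λ _ → ⊥ ; nonneg = λ _ () ; convex = λ _ _ _ () }

edgeless-2IntervalPCG : ∀ {n} (G : Graph n) → LabelledTree n → (∀ p q → ¬ Adj G p q) → Is2IntervalPCG G
edgeless-2IntervalPCG G 𝒯 edgeless =
  _ , tree 𝒯 , labelling 𝒯 , ∅ᴵ , ∅ᴵ , (λ _ ()) ,
  λ p q _ → mk⇔ (⊥-elim ∘ edgeless p q) λ { (_ , _ , inj₁ ()) ; (_ , _ , inj₂ ()) }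

edgeless₂ : ∀ {G : Graph 2} {u x} → x ≢ u → ¬ Adj G u x → ∀ p q → ¬ Adj G p q
edgeless₂ {G} {zero}     {zero}     x≢u _   _          _          = ⊥-elim (x≢u refl)
edgeless₂ {G} {suc zero} {suc zero} x≢u _   _          _          = ⊥-elim (x≢u refl)
edgeless₂ {G} {_}        {_}        _   _   zero       zero       = irrefl G
edgeless₂ {G} {_}        {_}        _   _   (suc zero) (suc zero) = irrefl G
edgeless₂ {G} {zero}     {suc zero} _   u≁x zero       (suc zero) = u≁x
edgeless₂ {G} {zero}     {suc zero} _   u≁x (suc zero) zero       = u≁x ∘ sym G
edgeless₂ {G} {suc zero} {zero}     _   u≁x (suc zero) zero       = u≁x
edgeless₂ {G} {suc zero} {zero}     _   u≁x zero       (suc zero) = u≁x ∘ sym G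

theorem2 : ∀ (n : ℕ) (G : Graph (suc n)) (u : Fin (suc n)) →
           AlmostUniversal G u → IsPCG (removeVertex G u) → Is2IntervalPCG G
theorem2 zero          G zero (zero , x≢u , _) _ = ⊥-elim (x≢u refl)
theorem2 (suc zero)    G u (x , x≢u , u≁x , _) _ = edgeless-2IntervalPCG G edge (edgeless₂ {G} x≢u u≁x)
theorem2 (suc (suc k)) G u (x , x≢u , u≁x , u∼others) (_ , T , L , I , pcg) =
  Construction.is2IntervalPCG G u x x≢u u≁x u∼others (labelled T L) I pcg
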